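{- For $n \geq 1$ and $k \geq 0$, $\mathscr{I}(P_n) \cong K_1$ if $n = 3k$, and $\mathscr{I}(P_n) \cong P_{k+2}$ if $n = 3k+2$.
   Context: For a graph $G$, an $i$-set is an independent dominating set of minimum size. The $i$-graph $\mathscr{I}(G)$ has the $i$-sets of $G$ as vertices, with $X,Y$ adjacent if and only if there is an edge $xy\in E(G)$ with $x\in X$, $y \notin X$ and $Y=(X\setminus\{x\})\cup\{y\}$. $P_m$ is the path on $m$ vertices. -}

module Defs where

open import Data.Nat using (ℕ; suc; _+_; _≤_)
open import Data.Fin using (Fin; toℕ)
open import Data.Fin.Subset using (Subset; _∈_; _∉_; _∪_; _-_; ⁅_⁆; ∣_∣)
open import Data.Product using (Σ; _×_; ∃₂)
open import Data.Sum using (_⊎_)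
open import Data.Unit using (⊤)
open import Data.Empty using (⊥)
open import Relation.Nullary using (¬_)
open import Relation.Binary.PropositionalEquality using (_≡_)

record Graph : Set₁ where
  field
    Vertex : Set
    Adj    : Vertex → Vertex → Set
open Graph public

record _≅_ (G H : Graph) : Set where
  field
    to      : Vertex G → Vertex H
    from    : Vertex H → Vertex G
    from∘to : ∀ x → from (to x) ≡ x
    to∘from : ∀ y → to (from y) ≡ y
    adj-to  : ∀ x y → Adj G x y → Adj H (to x) (to y)
    adj-from : ∀ x y → Adj H (to x) (to y) → Adj G x y

PathAdj : (m : ℕ) → Fin m → Fin m → Set
PathAdj m i j = (suc (toℕ i) ≡ toℕ j) ⊎ (suc (toℕ j) ≡ toℕ i)

P : ℕ → Graph
P m = record { Vertex = Fin m ; Adj = PathAdj m }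

K₁ : Graph
K₁ = record { Vertex = ⊤ ; Adj = λ _ _ → ⊥ }

module _ {n : ℕ} (adj : Fin n → Fin n → Set) where

  Independent : Subset n → Set
  Independent S = ∀ x y → x ∈ S → y ∈ S → ¬ adj x y

  Dominating : Subset n → Set
  Dominating S = ∀ v → v ∈ S ⊎ Σ (Fin n) (λ u → u ∈ S × adj u v)

  IndDom : Subset n → Set
  IndDom S = Independent S × Dominating S

  IsISet : Subset n → Set
  IsISet S = IndDom S × (∀ T → IndDom T → ∣ S ∣ ≤ ∣ T ∣)

  -- vertices of the i-graph: i-sets (proof irrelevant, so two vertices
  -- are equal iff the underlying sets are)
  record ISet : Set where
    constructor iset
    field
      set    : Subset n
      .isISet : IsISet set
  open ISet public

  ISetAdj : ISet → ISet → Set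
  ISetAdj X Y = ∃₂ λ x y → adj x y × x ∈ set X × y ∉ set X
                  × set Y ≡ (set X - x) ∪ ⁅ y ⁆

  IGraph : Graph
  IGraph = record { Vertex = ISet ; Adj = ISetAdj }

IGraphP : ℕ → Graph
IGraphP m = IGraph (PathAdj m)

-- Read a subset of Pₙ as a bit string. Its independent dominating sets are exactly the words of the
-- grammar D ::= ε | 1F | 01F, F ::= ε | 0D, in which every 1 accounts for at most three letters.
-- Hence the i-sets of P₃ₖ have k elements and the only one is (010)ᵏ, while those of P₃ₖ₊₂ have
-- k + 1 elements and are the k + 2 words (010)ʲ10(010)ᵏ⁻ʲ and (010)ᵏ01. Consecutive ones differ by
-- sliding one element one step. Conversely, a slide along an edge changes the sum of the indices of
-- the set by ±1, while the index sum of the j-th word is j plus a constant, so no other pairs are adjacent.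
module Submission where

open import Defs
open import Data.Nat using (ℕ; zero; suc; _+_; _*_; _≤_; z≤n; s≤s; s≤s⁻¹)
open import Data.Nat.Properties
  using (suc-injective; +-commutativeSemigroup; +-suc; +-identityʳ; +-cancelˡ-≡; +-cancelʳ-≡; *-comm; +-comm;
         m≤n⇒m≤1+n; n≤1+n; ≤-trans; *-cancelʳ-≤; *-monoˡ-≤; <⇒≱; ≰⇒>)
open import Data.Nat.Tactic.RingSolver using (solve-∀)
open import Algebra.Properties.CommutativeSemigroup +-commutativeSemigroup
  using () renaming (x∙yz≈y∙xz to +-left-comm)
open import Data.Bool using (Bool)
open import Data.Bool.Properties using (∨-identityʳ) renaming (_≟_ to _≟ᵇ_)
open import Data.Fin using (Fin; zero; suc; toℕ)
open import Data.Fin.Subset using (Subset; inside; outside; _∈_; _∉_; _∪_; _─_; _-_; ⁅_⁆; ∣_∣)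
  renaming (⊥ to ∅)
open import Data.Fin.Subset.Properties using (x∈⁅x⁆; x∈p∪q⁺; p─⊥≡p; ∪-identityʳ; p─q⊆p)
open import Data.Vec using ([]; _∷_; here; there)
open import Data.Vec.Properties using (≡-dec)
open import Data.Product using (Σ; _×_; _,_; proj₁; ∃₂)
open import Data.Sum as Sum using (_⊎_; inj₁; inj₂)
open import Data.Unit using (tt)
open import Data.Empty using (⊥-elim)
open import Function using (_∘_)
open import Relation.Nullary using (¬_)
open import Relation.Nullary.Decidable using (recompute)
open import Relation.Binary.PropositionalEquality

private
  variable
    n k : ℕ
    b : Bool
    S T : Subset n
    v : Fin n

-- PathAdj m i j unfolds to toℕ i ~ toℕ j.
_~_ : ℕ → ℕ → Set
m ~ n = suc m ≡ n ⊎ suc n ≡ m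

~-sym : ∀ {m n} → m ~ n → n ~ m
~-sym = Sum.swap

~-suc⁺ : ∀ {m n} → m ~ n → suc m ~ suc n
~-suc⁺ = Sum.map (cong suc) (cong suc)

~-suc⁻ : ∀ {m n} → suc m ~ suc n → m ~ n
~-suc⁻ = Sum.map suc-injective suc-injective

~-irrefl : ∀ {m} → ¬ m ~ m
~-irrefl (inj₁ ())
~-irrefl (inj₂ ())

¬0~2+ : ∀ {m} → ¬ 0 ~ suc (suc m)
¬0~2+ (inj₁ ())
¬0~2+ (inj₂ ())

private
  +-cancel-suc : ∀ x c {a b} → x + (b + c) ≡ suc x + (a + c) → b ≡ suc a
  +-cancel-suc x c {a} {b} h = +-cancelʳ-≡ c b (suc a) (+-cancelˡ-≡ x _ _ (trans h (sym (+-suc x (a + c)))))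

~-transfer : ∀ {a b c x y} → x + (b + c) ≡ y + (a + c) → x ~ y → a ~ b
~-transfer {c = c} {x}     eq (inj₁ refl) = inj₁ (sym (+-cancel-suc x c eq))
~-transfer {c = c} {y = y} eq (inj₂ refl) = inj₂ (sym (+-cancel-suc y c (sym eq)))

DominatedBy : Subset n → Fin n → Set
DominatedBy {n} S v = v ∈ S ⊎ Σ (Fin n) (λ u → u ∈ S × PathAdj n u v)

independent-tail : Independent (PathAdj (suc n)) (b ∷ S) → Independent (PathAdj n) S
independent-tail ind x y x∈S y∈S = ind (suc x) (suc y) (there x∈S) (there y∈S) ∘ ~-suc⁺

independent-outside : Independent (PathAdj n) S → Independent (PathAdj (suc n)) (outside ∷ S)
independent-outside ind (suc x) (suc y) (there x∈S) (there y∈S) = ind x y x∈S y∈S ∘ ~-suc⁻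

independent-10 : Independent (PathAdj n) S → Independent (PathAdj (suc (suc n))) (inside ∷ outside ∷ S)
independent-10 ind zero    zero          _ _ = ~-irrefl
independent-10 ind zero    (suc zero)    _ (there ())
independent-10 ind zero    (suc (suc y)) _ _ = ¬0~2+
independent-10 ind (suc zero)    zero    (there ()) _
independent-10 ind (suc (suc x)) zero    _ _ = ¬0~2+ ∘ ~-sym
independent-10 ind (suc x) (suc y) (there x∈S) (there y∈S) = independent-outside ind x y x∈S y∈S ∘ ~-suc⁻

dominated-suc : DominatedBy S v → DominatedBy (b ∷ S) (suc v)
dominated-suc (inj₁ v∈S)           = inj₁ (there v∈S)
dominated-suc (inj₂ (u , u∈S , uv)) = inj₂ (suc u , there u∈S , ~-suc⁺ uv)

dominated-pred : DominatedBy (outside ∷ S) (suc v) → DominatedBy S v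
dominated-pred (inj₁ (there v∈S))             = inj₁ v∈S
dominated-pred (inj₂ (suc u , there u∈S , uv)) = inj₂ (u , u∈S , ~-suc⁻ uv)

dominated-skip : DominatedBy (b ∷ S) (suc (suc v)) → DominatedBy S (suc v)
dominated-skip (inj₁ (there v∈S))             = inj₁ v∈S
dominated-skip (inj₂ (zero , _ , uv))          = ⊥-elim (¬0~2+ uv)
dominated-skip (inj₂ (suc u , there u∈S , uv)) = inj₂ (u , u∈S , ~-suc⁻ uv)

IndDom-10⁺ : IndDom (PathAdj n) S → IndDom (PathAdj (suc (suc n))) (inside ∷ outside ∷ S)
IndDom-10⁺ (ind , dom) = independent-10 ind , λ where
  zero          → inj₁ here
  (suc zero)    → inj₂ (zero , here , inj₁ refl)
  (suc (suc v)) → dominated-suc (dominated-suc (dom v))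

IndDom-10⁻ : IndDom (PathAdj (suc (suc n))) (inside ∷ outside ∷ S) → IndDom (PathAdj n) S
IndDom-10⁻ (ind , dom) =
  independent-tail (independent-tail ind) , λ v → dominated-pred (dominated-skip (dom (suc (suc v))))

IndDom-01⁺ : IndDom (PathAdj (suc n)) (inside ∷ S) → IndDom (PathAdj (suc (suc n))) (outside ∷ inside ∷ S)
IndDom-01⁺ (ind , dom) = independent-outside ind , λ where
  zero    → inj₂ (suc zero , there here , inj₂ refl)
  (suc v) → dominated-suc (dom v)

IndDom-01⁻ : IndDom (PathAdj (suc (suc n))) (outside ∷ inside ∷ S) → IndDom (PathAdj (suc n)) (inside ∷ S)
IndDom-01⁻ (ind , dom) = independent-tail ind , λ v → dominated-pred (dom (suc v))

¬IndDom-11 : ¬ IndDom (PathAdj (suc (suc n))) (inside ∷ inside ∷ S)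
¬IndDom-11 (ind , _) = ind zero (suc zero) here (there here) (inj₁ refl)

¬IndDom-00 : ¬ IndDom (PathAdj (suc (suc n))) (outside ∷ outside ∷ S)
¬IndDom-00 (_ , dom) = undominated (dom zero)
  where
  undominated : ¬ DominatedBy (outside ∷ outside ∷ S) zero
  undominated (inj₂ (suc (suc u) , _ , uv))   = ¬0~2+ (~-sym uv)
  undominated (inj₁ ())
  undominated (inj₂ (zero , () , _))
  undominated (inj₂ (suc zero , there () , _))

¬IndDom-0 : ¬ IndDom (PathAdj 1) (outside ∷ [])
¬IndDom-0 (_ , dom) with dom zero
... | inj₁ ()
... | inj₂ (zero , () , _)

-- IDWord S holds iff S is an independent dominating set of its path, IDWord⁺ S iff inside ∷ S is one.
data IDWord : Subset n → Set
data IDWord⁺ : Subset n → Set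

data IDWord where
  ε    : IDWord []
  1·_  : IDWord⁺ S → IDWord (inside ∷ S)
  01·_ : IDWord⁺ S → IDWord (outside ∷ inside ∷ S)

data IDWord⁺ where
  ε   : IDWord⁺ []
  0·_ : IDWord S → IDWord⁺ (outside ∷ S)

IndDom⇒IDWord  : IndDom (PathAdj n) S → IDWord S
IndDom⇒IDWord⁺ : IndDom (PathAdj (suc n)) (inside ∷ S) → IDWord⁺ S

IndDom⇒IDWord {S = []}                    _ = ε
IndDom⇒IDWord {S = inside ∷ S}            h = 1· IndDom⇒IDWord⁺ h
IndDom⇒IDWord {S = outside ∷ []}          h = ⊥-elim (¬IndDom-0 h)
IndDom⇒IDWord {S = outside ∷ outside ∷ S} h = ⊥-elim (¬IndDom-00 h)
IndDom⇒IDWord {S = outside ∷ inside ∷ S}  h = 01· IndDom⇒IDWord⁺ (IndDom-01⁻ h)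

IndDom⇒IDWord⁺ {S = []}          _ = ε
IndDom⇒IDWord⁺ {S = inside ∷ S}  h = ⊥-elim (¬IndDom-11 h)
IndDom⇒IDWord⁺ {S = outside ∷ S} h = 0· IndDom⇒IDWord (IndDom-10⁻ h)

IDWord⇒IndDom  : IDWord S → IndDom (PathAdj n) S
IDWord⁺⇒IndDom : IDWord⁺ S → IndDom (PathAdj (suc n)) (inside ∷ S)

IDWord⇒IndDom ε        = (λ _ _ ()) , (λ ())
IDWord⇒IndDom (1· w)   = IDWord⁺⇒IndDom w
IDWord⇒IndDom (01· w)  = IndDom-01⁺ (IDWord⁺⇒IndDom w)

IDWord⁺⇒IndDom ε      = (λ { zero zero _ _ → ~-irrefl }) , (λ { zero → inj₁ here })
IDWord⁺⇒IndDom (0· w) = IndDom-10⁺ (IDWord⇒IndDom w)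

IDWord-length  : {S : Subset n} → IDWord S → n ≤ ∣ S ∣ * 3
IDWord⁺-length : {S : Subset n} → IDWord⁺ S → n ≤ suc (∣ S ∣ * 3)

IDWord-length ε       = z≤n
IDWord-length (1· w)  = s≤s (m≤n⇒m≤1+n (IDWord⁺-length w))
IDWord-length (01· w) = s≤s (s≤s (IDWord⁺-length w))

IDWord⁺-length ε      = z≤n
IDWord⁺-length (0· w) = s≤s (IDWord-length w)

Z : (k : ℕ) → Subset (k * 3)
Z zero    = []
Z (suc k) = outside ∷ inside ∷ outside ∷ Z k

-- W k j = (010)ʲ10(010)ᵏ⁻ʲ for j ≤ k, and W k (k + 1) = (010)ᵏ01.
W : (k : ℕ) → Fin (suc (suc k)) → Subset (suc (suc (k * 3)))
W k       zero       = inside ∷ outside ∷ Z k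
W zero    (suc zero) = outside ∷ inside ∷ []
W (suc k) (suc j)    = outside ∷ inside ∷ outside ∷ W k j

Z-IDWord : ∀ k → IDWord (Z k)
Z-IDWord zero    = ε
Z-IDWord (suc k) = 01· 0· Z-IDWord k

W-IDWord : ∀ k j → IDWord (W k j)
W-IDWord k       zero       = 1· 0· Z-IDWord k
W-IDWord zero    (suc zero) = 01· ε
W-IDWord (suc k) (suc j)    = 01· 0· W-IDWord k j

∣Z∣ : ∀ k → ∣ Z k ∣ ≡ k
∣Z∣ zero    = refl
∣Z∣ (suc k) = cong suc (∣Z∣ k)

∣W∣ : ∀ k j → ∣ W k j ∣ ≡ suc k
∣W∣ k       zero       = cong suc (∣Z∣ k)
∣W∣ zero    (suc zero) = refl
∣W∣ (suc k) (suc j)    = cong suc (∣W∣ k j)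

IDWord-Z-size : {S : Subset (k * 3)} → IDWord S → k ≤ ∣ S ∣
IDWord-Z-size {k} {S} w = *-cancelʳ-≤ k ∣ S ∣ 3 (IDWord-length w)

IDWord-W-size : {S : Subset (suc (suc (k * 3)))} → IDWord S → suc k ≤ ∣ S ∣
IDWord-W-size {k} {S} w = ≰⇒> λ ∣S∣≤k → <⇒≱ (≤-trans (n≤1+n _) (IDWord-length w)) (*-monoˡ-≤ 3 ∣S∣≤k)

IDWord-Z-unique : {S : Subset (k * 3)} → IDWord S → ∣ S ∣ ≤ k → S ≡ Z k
IDWord-Z-unique {zero}  ε            _       = refl
IDWord-Z-unique {suc k} (1· w)       (s≤s c) = ⊥-elim (<⇒≱ (s≤s⁻¹ (IDWord⁺-length w)) (*-monoˡ-≤ 3 c))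
IDWord-Z-unique {suc k} (01· 0· w)   (s≤s c) = cong (λ T → outside ∷ inside ∷ outside ∷ T) (IDWord-Z-unique w c)

IDWord-W-unique : {S : Subset (suc (suc (k * 3)))} → IDWord S → ∣ S ∣ ≤ suc k →
                  Σ (Fin (suc (suc k))) λ j → S ≡ W k j
IDWord-W-unique         (1· 0· w)  (s≤s c) = zero , cong (λ T → inside ∷ outside ∷ T) (IDWord-Z-unique w c)
IDWord-W-unique {zero}  (01· ε)    _       = suc zero , refl
IDWord-W-unique {suc k} (01· 0· w) (s≤s c) with IDWord-W-unique w c
... | j , refl = suc j , refl

Z-isISet : ∀ k → IsISet (PathAdj (k * 3)) (Z k)
Z-isISet k = IDWord⇒IndDom (Z-IDWord k) , λ T t →
  subst (_≤ ∣ T ∣) (sym (∣Z∣ k)) (IDWord-Z-size (IndDom⇒IDWord t))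

W-isISet : ∀ k j → IsISet (PathAdj (suc (suc (k * 3)))) (W k j)
W-isISet k j = IDWord⇒IndDom (W-IDWord k j) , λ T t →
  subst (_≤ ∣ T ∣) (sym (∣W∣ k j)) (IDWord-W-size (IndDom⇒IDWord t))

isISet⇒≡Z : {S : Subset (k * 3)} → IsISet (PathAdj (k * 3)) S → S ≡ Z k
isISet⇒≡Z {k} {S} (t , minimal) =
  IDWord-Z-unique (IndDom⇒IDWord t) (subst (∣ S ∣ ≤_) (∣Z∣ k) (minimal (Z k) (proj₁ (Z-isISet k))))

isISet⇒∃W : {S : Subset (suc (suc (k * 3)))} → IsISet (PathAdj (suc (suc (k * 3)))) S →
           Σ (Fin (suc (suc k))) λ j → S ≡ W k j
isISet⇒∃W {k} {S} (t , minimal) =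
  IDWord-W-unique (IndDom⇒IDWord t) (subst (∣ S ∣ ≤_) (∣W∣ k zero) (minimal (W k zero) (proj₁ (W-isISet k zero))))

W-index : ∀ k → Subset (suc (suc (k * 3))) → Fin (suc (suc k))
W-index k       (inside ∷ _)          = zero
W-index zero    (outside ∷ _)         = suc zero
W-index (suc k) (outside ∷ _ ∷ _ ∷ S) = suc (W-index k S)

W-index-W : ∀ k j → W-index k (W k j) ≡ j
W-index-W k       zero       = refl
W-index-W zero    (suc zero) = refl
W-index-W (suc k) (suc j)    = cong suc (W-index-W k j)

ISet-≡ : {adj : Fin n → Fin n → Set} {X Y : ISet adj} → set X ≡ set Y → X ≡ Y
ISet-≡ {X = iset S _} {Y = iset .S _} refl = refl

-- The i-set property is irrelevant, so the equations are recomputed from decidable equality.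
set-Z : (X : ISet (PathAdj (k * 3))) → set X ≡ Z k
set-Z {k} (iset S i) = recompute (≡-dec _≟ᵇ_ S (Z k)) (isISet⇒≡Z i)

set-W : (X : ISet (PathAdj (suc (suc (k * 3))))) → set X ≡ W k (W-index k (set X))
set-W {k} (iset S i) = recompute (≡-dec _≟ᵇ_ _ _) (W-at-index (isISet⇒∃W i))
  where
  W-at-index : Σ (Fin (suc (suc k))) (λ j → S ≡ W k j) → S ≡ W k (W-index k S)
  W-at-index (j , refl) = cong (W k) (sym (W-index-W k j))

-- indexSum o S = Σ_{i ∈ S} (o + i); the offset makes the recursion structural.
indexSum : ℕ → Subset n → ℕ
indexSum o []            = 0
indexSum o (outside ∷ S) = indexSum (suc o) S
indexSum o (inside ∷ S)  = o + indexSum (suc o) S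

private
  +-suc-rotate : ∀ o y r → o + (suc o + y + r) ≡ o + suc y + (o + r)
  +-suc-rotate = solve-∀

indexSum-∪⁅⁆ : ∀ o {y} → y ∉ S → indexSum o (S ∪ ⁅ y ⁆) ≡ o + toℕ y + indexSum o S
indexSum-∪⁅⁆ {S = inside ∷ _}  o {zero}  y∉S = ⊥-elim (y∉S here)
indexSum-∪⁅⁆ {S = outside ∷ S} o {zero}  _   =
  cong₂ _+_ (sym (+-identityʳ o)) (cong (indexSum (suc o)) (∪-identityʳ S))
indexSum-∪⁅⁆ {S = outside ∷ S} o {suc y} y∉S =
  trans (indexSum-∪⁅⁆ (suc o) (y∉S ∘ there)) (cong (_+ indexSum (suc o) S) (sym (+-suc o (toℕ y))))
indexSum-∪⁅⁆ {S = inside ∷ S}  o {suc y} y∉S =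
  trans (cong (o +_) (indexSum-∪⁅⁆ (suc o) (y∉S ∘ there))) (+-suc-rotate o (toℕ y) (indexSum (suc o) S))

indexSum-─ : ∀ o {x} → x ∈ S → indexSum o S ≡ o + toℕ x + indexSum o (S - x)
indexSum-─ {S = inside ∷ S}  o {zero}  here =
  cong₂ _+_ (sym (+-identityʳ o)) (cong (indexSum (suc o)) (sym (p─⊥≡p S)))
indexSum-─ {S = outside ∷ S} o {suc x} (there x∈S) =
  trans (indexSum-─ (suc o) x∈S) (cong (_+ indexSum (suc o) (S - x)) (sym (+-suc o (toℕ x))))
indexSum-─ {S = inside ∷ S}  o {suc x} (there x∈S) =
  trans (cong (o +_) (indexSum-─ (suc o) x∈S)) (+-suc-rotate o (toℕ x) (indexSum (suc o) (S - x)))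

indexSum-slide : ∀ o {x y} → x ∈ S → y ∉ S →
                 o + toℕ x + indexSum o ((S - x) ∪ ⁅ y ⁆) ≡ o + toℕ y + indexSum o S
indexSum-slide {S = S} o {x} {y} x∈S y∉S = begin
  o + toℕ x + indexSum o ((S - x) ∪ ⁅ y ⁆)     ≡⟨ cong (o + toℕ x +_) (indexSum-∪⁅⁆ o (y∉S ∘ p─q⊆p S ⁅ x ⁆)) ⟩
  o + toℕ x + (o + toℕ y + indexSum o (S - x)) ≡⟨ +-left-comm (o + toℕ x) (o + toℕ y) _ ⟩
  o + toℕ y + (o + toℕ x + indexSum o (S - x)) ≡⟨ cong (o + toℕ y +_) (indexSum-─ o x∈S) ⟨
  o + toℕ y + indexSum o S                     ∎
  where open ≡-Reasoning

indexSum-W : ∀ o k j → indexSum o (W k j) ≡ toℕ j + (o + indexSum (suc (suc o)) (Z k))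
indexSum-W o k       zero       = refl
indexSum-W o zero    (suc zero) = refl
indexSum-W o (suc k) (suc j)    =
  trans (cong (suc o +_) (indexSum-W (suc (suc (suc o))) k j)) (cong suc (+-left-comm o (toℕ j) _))

-- ISetAdj adj X Y unfolds to Slide adj (set X) (set Y).
Slide : (Fin n → Fin n → Set) → Subset n → Subset n → Set
Slide adj S T = ∃₂ λ x y → adj x y × x ∈ S × y ∉ S × T ≡ (S - x) ∪ ⁅ y ⁆

¬Slide-refl : {adj : Fin n → Fin n → Set} → ¬ Slide adj S S
¬Slide-refl (_ , y , _ , _ , y∉S , S≡) = y∉S (subst (y ∈_) (sym S≡) (x∈p∪q⁺ (inj₂ (x∈⁅x⁆ y))))

slide-∷ : ∀ b → Slide (PathAdj n) S T → Slide (PathAdj (suc n)) (b ∷ S) (b ∷ T)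
slide-∷ b (x , y , xy , x∈S , y∉S , refl) =
  suc x , suc y , ~-suc⁺ xy , there x∈S , (λ { (there y∈S) → y∉S y∈S }) , cong (_∷ _) (sym (∨-identityʳ b))

─∅∪∅ : (S : Subset n) → (S ─ ∅) ∪ ∅ ≡ S
─∅∪∅ S = trans (∪-identityʳ (S ─ ∅)) (p─⊥≡p S)

slide-10→01 : Slide (PathAdj (suc (suc n))) (inside ∷ outside ∷ S) (outside ∷ inside ∷ S)
slide-10→01 {S = S} =
  zero , suc zero , inj₁ refl , here , (λ { (there ()) }) , cong (λ T → outside ∷ inside ∷ T) (sym (─∅∪∅ S))

slide-01→10 : Slide (PathAdj (suc (suc n))) (outside ∷ inside ∷ S) (inside ∷ outside ∷ S)
slide-01→10 {S = S} =
  suc zero , zero , inj₂ refl , there here , (λ ()) , cong (λ T → inside ∷ outside ∷ T) (sym (─∅∪∅ S))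

W-slide : {a b : Fin (suc (suc k))} → suc (toℕ a) ≡ toℕ b → Slide (PathAdj _) (W k a) (W k b)
W-slide {zero}  {zero}  {suc zero} refl = slide-10→01
W-slide {suc k} {zero}  {suc zero} refl = slide-10→01
W-slide {suc k} {suc a} {suc b}    e    =
  slide-∷ outside (slide-∷ inside (slide-∷ outside (W-slide (suc-injective e))))

W-slide⁻ : {a b : Fin (suc (suc k))} → suc (toℕ a) ≡ toℕ b → Slide (PathAdj _) (W k b) (W k a)
W-slide⁻ {zero}  {zero}  {suc zero} refl = slide-01→10
W-slide⁻ {suc k} {zero}  {suc zero} refl = slide-01→10
W-slide⁻ {suc k} {suc a} {suc b}    e    =
  slide-∷ outside (slide-∷ inside (slide-∷ outside (W-slide⁻ (suc-injective e))))

PathAdj⇒W-slide : {a b : Fin (suc (suc k))} → PathAdj _ a b → Slide (PathAdj _) (W k a) (W k b)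
PathAdj⇒W-slide (inj₁ e) = W-slide e
PathAdj⇒W-slide (inj₂ e) = W-slide⁻ e

W-slide⇒PathAdj : {a b : Fin (suc (suc k))} → Slide (PathAdj _) (W k a) (W k b) → PathAdj _ a b
W-slide⇒PathAdj {k} {a} {b} (x , y , xy , x∈W , y∉W , W≡) = ~-transfer balance xy
  where
  balance : toℕ x + (toℕ b + indexSum 2 (Z k)) ≡ toℕ y + (toℕ a + indexSum 2 (Z k))
  balance = begin
    toℕ x + (toℕ b + indexSum 2 (Z k))       ≡⟨ cong (toℕ x +_) (indexSum-W 0 k b) ⟨
    toℕ x + indexSum 0 (W k b)               ≡⟨ cong (λ T → toℕ x + indexSum 0 T) W≡ ⟩
    toℕ x + indexSum 0 ((W k a - x) ∪ ⁅ y ⁆) ≡⟨ indexSum-slide 0 x∈W y∉W ⟩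
    toℕ y + indexSum 0 (W k a)               ≡⟨ cong (toℕ y +_) (indexSum-W 0 k a) ⟩
    toℕ y + (toℕ a + indexSum 2 (Z k))       ∎
    where open ≡-Reasoning

IGraph-Z≅K₁ : ∀ k → IGraphP (k * 3) ≅ K₁
IGraph-Z≅K₁ k = record
  { to       = λ _ → tt
  ; from     = λ _ → iset (Z k) (Z-isISet k)
  ; from∘to  = λ X → ISet-≡ (sym (set-Z {k} X))
  ; to∘from  = λ _ → refl
  ; adj-to   = λ X Y X~Y → ¬Slide-refl (subst₂ (Slide _) (set-Z {k} X) (set-Z {k} Y) X~Y)
  ; adj-from = λ _ _ ()
  }

IGraph-W≅P : ∀ k → IGraphP (suc (suc (k * 3))) ≅ P (suc (suc k))
IGraph-W≅P k = record
  { to       = λ X → W-index k (set X)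
  ; from     = λ j → iset (W k j) (W-isISet k j)
  ; from∘to  = λ X → ISet-≡ (sym (set-W X))
  ; to∘from  = W-index-W k
  ; adj-to   = λ X Y X~Y → W-slide⇒PathAdj (subst₂ (Slide _) (set-W X) (set-W Y) X~Y)
  ; adj-from = λ X Y a~b → subst₂ (Slide _) (sym (set-W X)) (sym (set-W Y)) (PathAdj⇒W-slide a~b)
  }

mainTheorem7 : (n k : ℕ) → 1 ≤ n →
    (n ≡ 3 * k → IGraphP n ≅ K₁) × (n ≡ 3 * k + 2 → IGraphP n ≅ P (k + 2))
mainTheorem7 n k _ = (λ { refl → subst (λ m → IGraphP m ≅ K₁) (*-comm k 3) (IGraph-Z≅K₁ k) })
                   , (λ { refl → subst₂ (λ m l → IGraphP m ≅ P l) length-W (+-comm 2 k) (IGraph-W≅P k) })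
  where
  length-W : suc (suc (k * 3)) ≡ 3 * k + 2
  length-W = trans (cong (2 +_) (*-comm k 3)) (+-comm 2 (3 * k))
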